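{- Let $\varphi,\psi\in\mathcal L$ and let $\Gamma\subseteq\mathcal L$ be finite. Then the following formulas belong to $\mathsf{GTL}$: (a) $\mathsf X(\bigvee\Gamma)\Leftrightarrow\bigvee\mathsf X\Gamma$; (b) $\mathsf X(\bigwedge\Gamma)\Leftrightarrow\bigwedge\mathsf X\Gamma$; (c) $\varphi\,\mathsf U\,\psi\Rightarrow\mathsf F\psi$; (d) $\varphi\,\mathsf U\,\psi\Rightarrow\psi\vee(\varphi\wedge\mathsf X(\varphi\,\mathsf U\,\psi))$; (e) $\varphi\wedge\mathsf X\mathsf G\varphi\Rightarrow\mathsf G\varphi$; (f) $(\varphi\Leftarrow\varphi)\Rightarrow\psi$; (g) $\mathsf Y(\bigvee\Gamma)\Leftrightarrow\bigvee\mathsf Y\Gamma$; (h) $\mathsf Y(\bigwedge\Gamma)\Leftrightarrow\bigwedge\mathsf Y\Gamma$; (i) $\varphi\,\mathsf S\,\psi\Rightarrow\mathsf P\psi$; (j) $\varphi\,\mathsf S\,\psi\Rightarrow\psi\vee(\varphi\wedge\mathsf Y(\varphi\,\mathsf S\,\psi))$; (k) $\varphi\wedge\mathsf Y\mathsf H\varphi\Rightarrow\mathsf H\varphi$; (l) $(\varphi\Leftarrow\psi)\Rightarrow\varphi$.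
   Context: Language $\mathcal L$ over a countably infinite set $\mathbb P$ of variables: $\varphi ::= p\mid\varphi\wedge\psi\mid\varphi\vee\psi\mid\varphi\Rightarrow\psi\mid\varphi\Leftarrow\psi\mid\mathsf X\varphi\mid\mathsf Y\varphi\mid\mathsf G\varphi\mid\mathsf H\varphi\mid\varphi\,\mathsf U\,\psi\mid\varphi\,\mathsf S\,\psi$. Abbreviations: $\top:=p\Rightarrow p$, $\bot:=p\Leftarrow p$ (fixed $p$), $\neg\varphi:=\varphi\Rightarrow\bot$, $\varphi\Leftrightarrow\psi:=(\varphi\Rightarrow\psi)\wedge(\psi\Rightarrow\varphi)$, $\mathsf F\varphi:=\top\,\mathsf U\,\varphi$, $\mathsf P\varphi:=\top\,\mathsf S\,\varphi$. For finite $\Gamma$, $\mathsf X\Gamma=\{\mathsf X\gamma:\gamma\in\Gamma\}$, $\mathsf Y\Gamma=\{\mathsf Y\gamma:\gamma\in\Gamma\}$, $\bigwedge\varnothing=\top$, $\bigvee\varnothing=\bot$. $\mathsf{GTL}$ is the least set of $\mathcal L$-formulas containing: (I) all substitution instances of intuitionistic propositional tautologies; (II) $\varphi\Rightarrow(\psi\vee(\varphi\Leftarrow\psi))$; (III) $(\varphi\Rightarrow\psi)\vee(\psi\Rightarrow\varphi)$ and $\neg((\varphi\Leftarrow\psi)\wedge(\psi\Leftarrow\varphi))$; (IV) $\neg\mathsf X\bot$; $\mathsf X(\varphi\vee\psi)\Rightarrow(\mathsf X\varphi\vee\mathsf X\psi)$; $(\mathsf X\varphi\wedge\mathsf X\psi)\Rightarrow\mathsf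 X(\varphi\wedge\psi)$; $\mathsf X(\varphi\Rightarrow\psi)\Leftrightarrow(\mathsf X\varphi\Rightarrow\mathsf X\psi)$; $\mathsf G(\varphi\Rightarrow\psi)\Rightarrow(\mathsf G\varphi\Rightarrow\mathsf G\psi)$; $\mathsf G(\varphi\Rightarrow\psi)\Rightarrow(\theta\,\mathsf U\,\varphi\Rightarrow\theta\,\mathsf U\,\psi)$; $\mathsf G(\varphi\Rightarrow\psi)\Rightarrow(\varphi\,\mathsf U\,\theta\Rightarrow\psi\,\mathsf U\,\theta)$; $\mathsf G\varphi\Rightarrow\varphi\wedge\mathsf X\mathsf G\varphi$; $\psi\vee(\varphi\wedge\mathsf X(\varphi\,\mathsf U\,\psi))\Rightarrow\varphi\,\mathsf U\,\psi$; $\mathsf G(\varphi\Rightarrow\mathsf X\varphi)\Rightarrow(\varphi\Rightarrow\mathsf G\varphi)$; $\mathsf G(\psi\wedge\mathsf X\varphi\Rightarrow\varphi)\Rightarrow(\psi\,\mathsf U\,\varphi\Rightarrow\varphi)$; and the same eleven axioms with $\mathsf X,\mathsf G,\mathsf U$ replaced by $\mathsf Y,\mathsf H,\mathsf S$; (V) $\varphi\Leftrightarrow\mathsf X\mathsf Y\varphi$ and $\varphi\Leftrightarrow\mathsf Y\mathsf X\varphi$; closed under the rules: from $\varphi\Rightarrow\psi$ infer $(\varphi\Leftarrow\theta)\Rightarrow(\psi\Leftarrow\theta)$; from $\varphi\Rightarrow\psi\vee\gamma$ infer $(\varphi\Leftarrow\psi)\Rightarrow\gamma$; modus ponens; and from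 $\varphi$ infer each of $\mathsf X\varphi,\mathsf Y\varphi,\mathsf G\varphi,\mathsf H\varphi$. -}

module Defs where

open import Data.Nat using (ℕ; zero)
open import Data.List using (List; foldr; map)

infixr 6 _∧_
infixr 5 _∨_
infixr 4 _⇒_ _⇐_ _⇔_
infix 7 _U_ _S_

data Fm : Set where
  var : ℕ → Fm
  _∧_ _∨_ _⇒_ _⇐_ : Fm → Fm → Fm
  X Y G H : Fm → Fm
  _U_ _S_ : Fm → Fm → Fm

p₀ : Fm
p₀ = var zero

⊤ ⊥ : Fm
⊤ = p₀ ⇒ p₀
⊥ = p₀ ⇐ p₀

¬_ : Fm → Fm
¬ φ = φ ⇒ ⊥

_⇔_ : Fm → Fm → Fm
φ ⇔ ψ = (φ ⇒ ψ) ∧ (ψ ⇒ φ)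

F P : Fm → Fm
F φ = ⊤ U φ
P φ = ⊤ S φ

⋀ ⋁ : List Fm → Fm
⋀ Γ = foldr _∧_ ⊤ Γ
⋁ Γ = foldr _∨_ ⊥ Γ

XΓ YΓ : List Fm → List Fm
XΓ Γ = map X Γ
YΓ Γ = map Y Γ

-- Intuitionistic propositional logic (language ∧ ∨ → ⊥ over variables ℕ),
-- given by a standard (sound and complete) Hilbert system.

infixr 6 _i∧_
infixr 5 _i∨_
infixr 4 _i⇒_

data IFm : Set where
  ivar : ℕ → IFm
  i⊥ : IFm
  _i∧_ _i∨_ _i⇒_ : IFm → IFm → IFm

data IPC : IFm → Set where
  k   : ∀ {a b} → IPC (a i⇒ (b i⇒ a))
  s   : ∀ {a b c} → IPC ((a i⇒ (b i⇒ c)) i⇒ ((a i⇒ b) i⇒ (a i⇒ c)))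
  ∧e₁ : ∀ {a b} → IPC ((a i∧ b) i⇒ a)
  ∧e₂ : ∀ {a b} → IPC ((a i∧ b) i⇒ b)
  ∧i  : ∀ {a b} → IPC (a i⇒ (b i⇒ (a i∧ b)))
  ∨i₁ : ∀ {a b} → IPC (a i⇒ (a i∨ b))
  ∨i₂ : ∀ {a b} → IPC (b i⇒ (a i∨ b))
  ∨e  : ∀ {a b c} → IPC ((a i⇒ c) i⇒ ((b i⇒ c) i⇒ ((a i∨ b) i⇒ c)))
  efq : ∀ {a} → IPC (i⊥ i⇒ a)
  mp  : ∀ {a b} → IPC (a i⇒ b) → IPC a → IPC b

inst : (ℕ → Fm) → IFm → Fm
inst σ (ivar n) = σ n
inst σ i⊥ = ⊥
inst σ (a i∧ b) = inst σ a ∧ inst σ b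
inst σ (a i∨ b) = inst σ a ∨ inst σ b
inst σ (a i⇒ b) = inst σ a ⇒ inst σ b

data Dir : Set where
  fut past : Dir

Nx Bx : Dir → Fm → Fm
Nx fut = X
Nx past = Y
Bx fut = G
Bx past = H

Un : Dir → Fm → Fm → Fm
Un fut = _U_
Un past = _S_

data GTL : Fm → Set where
  ipc : ∀ σ a → IPC a → GTL (inst σ a)
  ax-cop : ∀ φ ψ → GTL (φ ⇒ (ψ ∨ (φ ⇐ ψ)))
  ax-lin : ∀ φ ψ → GTL ((φ ⇒ ψ) ∨ (ψ ⇒ φ))
  ax-colin : ∀ φ ψ → GTL (¬ ((φ ⇐ ψ) ∧ (ψ ⇐ φ)))
  ax-nbot : ∀ d → GTL (¬ (Nx d ⊥))
  ax-ndis : ∀ d φ ψ → GTL (Nx d (φ ∨ ψ) ⇒ (Nx d φ ∨ Nx d ψ))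
  ax-ncon : ∀ d φ ψ → GTL ((Nx d φ ∧ Nx d ψ) ⇒ Nx d (φ ∧ ψ))
  ax-nimp : ∀ d φ ψ → GTL (Nx d (φ ⇒ ψ) ⇔ (Nx d φ ⇒ Nx d ψ))
  ax-bk : ∀ d φ ψ → GTL (Bx d (φ ⇒ ψ) ⇒ (Bx d φ ⇒ Bx d ψ))
  ax-ur : ∀ d φ ψ θ → GTL (Bx d (φ ⇒ ψ) ⇒ (Un d θ φ ⇒ Un d θ ψ))
  ax-ul : ∀ d φ ψ θ → GTL (Bx d (φ ⇒ ψ) ⇒ (Un d φ θ ⇒ Un d ψ θ))
  ax-bfix : ∀ d φ → GTL (Bx d φ ⇒ (φ ∧ Nx d (Bx d φ)))
  ax-ufix : ∀ d φ ψ → GTL ((ψ ∨ (φ ∧ Nx d (Un d φ ψ))) ⇒ Un d φ ψ)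
  ax-bind : ∀ d φ → GTL (Bx d (φ ⇒ Nx d φ) ⇒ (φ ⇒ Bx d φ))
  ax-uind : ∀ d φ ψ → GTL (Bx d ((ψ ∧ Nx d φ) ⇒ φ) ⇒ (Un d ψ φ ⇒ φ))
  ax-xy : ∀ φ → GTL (φ ⇔ X (Y φ))
  ax-yx : ∀ φ → GTL (φ ⇔ Y (X φ))
  r-cimp : ∀ φ ψ θ → GTL (φ ⇒ ψ) → GTL ((φ ⇐ θ) ⇒ (ψ ⇐ θ))
  r-cres : ∀ φ ψ γ → GTL (φ ⇒ (ψ ∨ γ)) → GTL ((φ ⇐ ψ) ⇒ γ)
  r-mp : ∀ φ ψ → GTL (φ ⇒ ψ) → GTL φ → GTL ψ
  r-X : ∀ φ → GTL φ → GTL (X φ)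
  r-Y : ∀ φ → GTL φ → GTL (Y φ)
  r-G : ∀ φ → GTL φ → GTL (G φ)
  r-H : ∀ φ → GTL φ → GTL (H φ)

-- (a),(b),(g),(h) are proved by induction on Γ from the axioms making X and Y
-- commute with ∨, ∧, ⇒ and ⊥. The fixpoint facts (d),(e) are the converses of
-- the fixpoint axioms, obtained by applying the induction axioms to the
-- one-step unfoldings themselves; (c),(i) are monotonicity of U and S in the
-- left argument. (f),(l) are instances of the residuation rule for ⇐.
module Submission where

open import Data.List using (List; []; _∷_; map)
open import Data.Nat using (ℕ; zero; suc)
open import Data.Product using (_×_; _,_)

open import Defs

substitution₃ : Fm → Fm → Fm → ℕ → Fm
substitution₃ a b c zero          = a
substitution₃ a b c (suc zero)    = b
substitution₃ a b c (suc (suc _)) = c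

⇒-const : ∀ a b → GTL (a ⇒ (b ⇒ a))
⇒-const a b = ipc (substitution₃ a b a) _ (k {ivar 0} {ivar 1})

⇒-dist : ∀ a b c → GTL ((a ⇒ (b ⇒ c)) ⇒ ((a ⇒ b) ⇒ (a ⇒ c)))
⇒-dist a b c = ipc (substitution₃ a b c) _ (s {ivar 0} {ivar 1} {ivar 2})

∧-proj₁ : ∀ a b → GTL ((a ∧ b) ⇒ a)
∧-proj₁ a b = ipc (substitution₃ a b a) _ (∧e₁ {ivar 0} {ivar 1})

∧-proj₂ : ∀ a b → GTL ((a ∧ b) ⇒ b)
∧-proj₂ a b = ipc (substitution₃ a b a) _ (∧e₂ {ivar 0} {ivar 1})

∧-intro : ∀ a b → GTL (a ⇒ (b ⇒ (a ∧ b)))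
∧-intro a b = ipc (substitution₃ a b a) _ (∧i {ivar 0} {ivar 1})

∨-inj₁ : ∀ a b → GTL (a ⇒ (a ∨ b))
∨-inj₁ a b = ipc (substitution₃ a b a) _ (∨i₁ {ivar 0} {ivar 1})

∨-inj₂ : ∀ a b → GTL (b ⇒ (a ∨ b))
∨-inj₂ a b = ipc (substitution₃ a b a) _ (∨i₂ {ivar 0} {ivar 1})

∨-elim : ∀ a b c → GTL ((a ⇒ c) ⇒ ((b ⇒ c) ⇒ ((a ∨ b) ⇒ c)))
∨-elim a b c = ipc (substitution₃ a b c) _ (∨e {ivar 0} {ivar 1} {ivar 2})

⊥-elim : ∀ a → GTL (⊥ ⇒ a)
⊥-elim a = ipc (substitution₃ a a a) _ (efq {ivar 0})

infixl 9 _·_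

_·_ : ∀ {a b} → GTL (a ⇒ b) → GTL a → GTL b
_·_ {a} {b} = r-mp a b

⇒-weaken : ∀ {a b} → GTL b → GTL (a ⇒ b)
⇒-weaken {a} {b} ⊢b = ⇒-const b a · ⊢b

⇒-app : ∀ {h a b} → GTL (h ⇒ (a ⇒ b)) → GTL (h ⇒ a) → GTL (h ⇒ b)
⇒-app {h} {a} {b} f x = ⇒-dist h a b · f · x

⇒-refl : ∀ a → GTL (a ⇒ a)
⇒-refl a = ⇒-dist a (a ⇒ a) a · ⇒-const a (a ⇒ a) · ⇒-const a a

⇒-trans : ∀ {a b c} → GTL (a ⇒ b) → GTL (b ⇒ c) → GTL (a ⇒ c)
⇒-trans ab bc = ⇒-app (⇒-weaken bc) ab

⇒-pair : ∀ {h a b} → GTL (h ⇒ a) → GTL (h ⇒ b) → GTL (h ⇒ (a ∧ b))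
⇒-pair {h} {a} {b} x y = ⇒-app (⇒-app (⇒-weaken (∧-intro a b)) x) y

⇒-case : ∀ {a b c} → GTL (a ⇒ c) → GTL (b ⇒ c) → GTL ((a ∨ b) ⇒ c)
⇒-case {a} {b} {c} f g = ∨-elim a b c · f · g

⊤-intro : GTL ⊤
⊤-intro = ⇒-refl p₀

⇔-intro : ∀ {a b} → GTL (a ⇒ b) → GTL (b ⇒ a) → GTL (a ⇔ b)
⇔-intro f g = ∧-intro _ _ · f · g

⇔-to : ∀ {a b} → GTL (a ⇔ b) → GTL (a ⇒ b)
⇔-to a⇔b = ∧-proj₁ _ _ · a⇔b

⇔-from : ∀ {a b} → GTL (a ⇔ b) → GTL (b ⇒ a)
⇔-from a⇔b = ∧-proj₂ _ _ · a⇔b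

Nx-necessitation : ∀ d {φ} → GTL φ → GTL (Nx d φ)
Nx-necessitation fut  = r-X _
Nx-necessitation past = r-Y _

Bx-necessitation : ∀ d {φ} → GTL φ → GTL (Bx d φ)
Bx-necessitation fut  = r-G _
Bx-necessitation past = r-H _

Nx-mono : ∀ d {a b} → GTL (a ⇒ b) → GTL (Nx d a ⇒ Nx d b)
Nx-mono d {a} {b} a⇒b = ⇔-to (ax-nimp d a b) · Nx-necessitation d a⇒b

Nx-⋁ : ∀ d (Γ : List Fm) → GTL (Nx d (⋁ Γ) ⇔ ⋁ (map (Nx d) Γ))
Nx-⋁ d []      = ⇔-intro (ax-nbot d) (⊥-elim _)
Nx-⋁ d (a ∷ Γ) = ⇔-intro
  (⇒-trans (ax-ndis d a (⋁ Γ))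
           (⇒-case (∨-inj₁ _ _) (⇒-trans (⇔-to (Nx-⋁ d Γ)) (∨-inj₂ _ _))))
  (⇒-case (Nx-mono d (∨-inj₁ _ _))
          (⇒-trans (⇔-from (Nx-⋁ d Γ)) (Nx-mono d (∨-inj₂ _ _))))

Nx-⋀ : ∀ d (Γ : List Fm) → GTL (Nx d (⋀ Γ) ⇔ ⋀ (map (Nx d) Γ))
Nx-⋀ d []      = ⇔-intro (⇒-weaken ⊤-intro) (⇒-weaken (Nx-necessitation d ⊤-intro))
Nx-⋀ d (a ∷ Γ) = ⇔-intro
  (⇒-pair (Nx-mono d (∧-proj₁ _ _))
          (⇒-trans (Nx-mono d (∧-proj₂ _ _)) (⇔-to (Nx-⋀ d Γ))))
  (⇒-trans (⇒-pair (∧-proj₁ _ _) (⇒-trans (∧-proj₂ _ _) (⇔-from (Nx-⋀ d Γ))))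
           (ax-ncon d a (⋀ Γ)))

Un⇒eventually : ∀ d φ ψ → GTL (Un d φ ψ ⇒ Un d ⊤ ψ)
Un⇒eventually d φ ψ = ax-ul d φ ⊤ ψ · Bx-necessitation d (⇒-weaken ⊤-intro)

-- Un d φ ψ ⇒ Un d φ χ by monotonicity, and χ absorbs φ ∧ Nx d χ because
-- Nx d χ ⇒ Nx d (Un d φ ψ) by the fixpoint axiom; so U-induction closes it.
Un-unfold : ∀ d φ ψ → GTL (Un d φ ψ ⇒ (ψ ∨ (φ ∧ Nx d (Un d φ ψ))))
Un-unfold d φ ψ =
  ⇒-trans (ax-ur d ψ χ φ · Bx-necessitation d (∨-inj₁ _ _))
          (ax-uind d χ φ · Bx-necessitation d step-absorbed)
  where
  χ : Fm
  χ = ψ ∨ (φ ∧ Nx d (Un d φ ψ))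

  step-absorbed : GTL ((φ ∧ Nx d χ) ⇒ χ)
  step-absorbed = ⇒-trans
    (⇒-pair (∧-proj₁ _ _) (⇒-trans (∧-proj₂ _ _) (Nx-mono d (ax-ufix d φ ψ))))
    (∨-inj₂ _ _)

-- θ is Nx-invariant by the fixpoint axiom for Bx, so Bx-induction gives θ ⇒ Bx θ.
Bx-fold : ∀ d φ → GTL ((φ ∧ Nx d (Bx d φ)) ⇒ Bx d φ)
Bx-fold d φ =
  ⇒-trans (ax-bind d θ · Bx-necessitation d θ-invariant)
          (ax-bk d θ φ · Bx-necessitation d (∧-proj₁ _ _))
  where
  θ : Fm
  θ = φ ∧ Nx d (Bx d φ)

  θ-invariant : GTL (θ ⇒ Nx d θ)
  θ-invariant = ⇒-trans (∧-proj₂ _ _) (Nx-mono d (ax-bfix d φ))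

⇐-self-explosion : ∀ φ ψ → GTL ((φ ⇐ φ) ⇒ ψ)
⇐-self-explosion φ ψ = r-cres φ φ ψ (∨-inj₁ _ _)

⇐-proj : ∀ φ ψ → GTL ((φ ⇐ ψ) ⇒ φ)
⇐-proj φ ψ = r-cres φ ψ φ (∨-inj₂ _ _)

lemma7p3 : (φ ψ : Fm) (Γ : List Fm) →
    GTL (X (⋁ Γ) ⇔ ⋁ (XΓ Γ))
    × GTL (X (⋀ Γ) ⇔ ⋀ (XΓ Γ))
    × GTL ((φ U ψ) ⇒ F ψ)
    × GTL ((φ U ψ) ⇒ (ψ ∨ (φ ∧ X (φ U ψ))))
    × GTL ((φ ∧ X (G φ)) ⇒ G φ)
    × GTL ((φ ⇐ φ) ⇒ ψ)
    × GTL (Y (⋁ Γ) ⇔ ⋁ (YΓ Γ))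
    × GTL (Y (⋀ Γ) ⇔ ⋀ (YΓ Γ))
    × GTL ((φ S ψ) ⇒ P ψ)
    × GTL ((φ S ψ) ⇒ (ψ ∨ (φ ∧ Y (φ S ψ))))
    × GTL ((φ ∧ Y (H φ)) ⇒ H φ)
    × GTL ((φ ⇐ ψ) ⇒ φ)
lemma7p3 φ ψ Γ =
  Nx-⋁ fut Γ , Nx-⋀ fut Γ ,
  Un⇒eventually fut φ ψ , Un-unfold fut φ ψ , Bx-fold fut φ ,
  ⇐-self-explosion φ ψ ,
  Nx-⋁ past Γ , Nx-⋀ past Γ ,
  Un⇒eventually past φ ψ , Un-unfold past φ ψ , Bx-fold past φ ,
  ⇐-proj φ ψ
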